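{- Let $m\ge 1$ and $n\ge 1$, and let $W_n^{(m)}(1-21,2-12)$ be the set of words of length $n$ on $\{1,\dots,m\}$ avoiding both generalized patterns $1-21$ and $2-12$. Then \[ |W_n^{(m)}(1-21,2-12)|=\sum_{k=1}^{n}\binom{m}{k}\,k\cdot (n-1)_{k-1}, \] where $(a)_b=a(a-1)\cdots(a-b+1)$ is the falling factorial (with $(a)_0=1$) and $\binom{m}{k}=0$ for $k>m$.
   Context: A word of length $n$ on $\{1,\dots,m\}$ (naturally ordered) is a sequence $w_1\cdots w_n$ of elements of $\{1,\dots,m\}$. A word $w$ contains the generalized pattern $1-21$ iff there exist indices $1\le i<j<n$ with $w_i=w_{j+1}<w_j$, and contains $2-12$ iff there exist $i<j<n$ with $w_i=w_{j+1}>w_j$; it avoids a pattern if it does not contain it. -}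

module Defs where

open import Data.Nat using (ℕ; zero; suc; _+_; _*_; _<_; _∸_)
open import Data.Nat.Combinatorics using (_C_; _P_)
open import Data.Fin using (Fin; toℕ)
import Data.Fin
open import Data.Fin.Base using () renaming (_<_ to _<ᶠ_)
open import Data.Vec using (Vec; lookup)
open import Data.Product using (∃-syntax; _×_; Σ)
open import Relation.Nullary using (¬_)
open import Relation.Binary.PropositionalEquality using (_≡_)

-- A word of length n on {1,…,m}: letters are Fin m (0 ↦ 1, …), with the natural order.
Word : ℕ → ℕ → Set
Word m n = Vec (Fin m) n

-- positions are 0-based: i < j and j+1 < n, i.e. 1 ≤ i < j < n in 1-based indexing.
-- w contains 1-21 iff ∃ i < j < n-1 (0-based) with w_i = w_{j+1} < w_j
Contains1-21 : ∀ {m n} → Word m n → Set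
Contains1-21 {m} {n} w =
  ∃[ i ] ∃[ j ] Σ (suc (toℕ j) < n) λ j+1<n →
    (toℕ i < toℕ j) ×
    (lookup w i ≡ lookup w (Data.Fin.fromℕ< j+1<n)) ×
    (lookup w (Data.Fin.fromℕ< j+1<n) <ᶠ lookup w j)

Contains2-12 : ∀ {m n} → Word m n → Set
Contains2-12 {m} {n} w =
  ∃[ i ] ∃[ j ] Σ (suc (toℕ j) < n) λ j+1<n →
    (toℕ i < toℕ j) ×
    (lookup w i ≡ lookup w (Data.Fin.fromℕ< j+1<n)) ×
    (lookup w j <ᶠ lookup w (Data.Fin.fromℕ< j+1<n))

Avoids : ∀ {m n} → Word m n → Set
Avoids w = ¬ Contains1-21 w × ¬ Contains2-12 w

sum1to : ℕ → (ℕ → ℕ) → ℕ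
sum1to zero    f = 0
sum1to (suc n) f = sum1to n f + f (suc n)

-- ∑_{k=1}^{n} C(m,k) · k · (n-1)_{k-1}   (a P b is the falling factorial (a)_b; m C k = 0 for k > m)
formula : ℕ → ℕ → ℕ
formula m n = sum1to n (λ k → (m C k) * k * ((n ∸ 1) P (k ∸ 1)))

module Submission where

-- Call a word *clustered* if, for every letter, its occurrences form
-- one contiguous block.  A word avoids both 1-21 and 2-12 iff it has no "re-entry"
-- i < j with w_i = w_{j+1} ≠ w_j (split ≠ into < and > by trichotomy), and this is
-- exactly clusteredness, described recursively: a ∷ w is clustered iff w is and every
-- occurrence of a in w lies in the initial run of w.
-- Clustered words of length n+2 over m+1 letters split by their first two letters: if
-- they agree, drop the first one; otherwise the first letter a never occurs again and
-- deleting a from the alphabet (punchOut) leaves a clustered word of length n+1 over m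
-- letters.  So the number c(m,n) of such words of length n+1 satisfies
--   c(m,0) = m,   c(0,n+1) = 0,   c(m+1,n+1) = c(m+1,n) + (m+1)·c(m,n).

open import Defs
open import Data.Bool.Base using (true; false; T)
open import Data.Nat.Base using (ℕ; zero; suc; _+_; _*_; _∸_; _≤_; _<_; _≤ᵇ_; s≤s; z≤n)
open import Data.Nat.Properties
open import Data.Nat.Combinatorics using (_C_; _P_; nCk+nC[k+1]≡[n+1]C[k+1]; nC1≡n)
open import Data.Nat.Combinatorics.Base using (_P′_)
open import Data.Nat.Tactic.RingSolver using (solve-∀)
open import Data.Fin.Base as F using (Fin; toℕ; fromℕ<; punchIn; punchOut)
open import Data.Fin.Properties as FP
  using (punchIn-injective; punchInᵢ≢i; punchIn-punchOut; punchOut-punchIn; +↔⊎; *↔×)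
open import Data.Vec.Base using ([]; _∷_; lookup; map)
open import Data.Vec.Relation.Unary.All using (All; []; _∷_)
open import Data.Product.Base using (Σ; _×_; _,_; proj₁; proj₂; ∃-syntax)
open import Data.Sum.Base using (_⊎_; inj₁; inj₂)
open import Data.Unit.Base using (⊤; tt)
open import Data.Empty using (⊥-elim)
open import Relation.Nullary using (¬_; yes; no)
open import Relation.Binary.Definitions using (tri<; tri≈; tri>)
open import Relation.Binary.PropositionalEquality
open import Function.Base using (_∘′_)
open import Function.Bundles using (_↔_; mk↔ₛ′)
open import Function.Properties.Inverse using (↔-trans; ↔-sym; ↔-refl)
open import Data.Sum.Function.Propositional using (_⊎-↔_)
open import Data.Product.Function.NonDependent.Propositional using (_×-↔_)

open ≡-Reasoning

falling : ℕ → ℕ → ℕ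
falling n       zero    = 1
falling zero    (suc k) = 0
falling (suc n) (suc k) = suc n * falling n k

-- The recursion (n)_{k+1} = (n - k)·(n)_k, which is how the library defines _P′_.
falling-step : ∀ n k → falling n (suc k) ≡ (n ∸ k) * falling n k
falling-step zero    k rewrite 0∸n≡0 k = refl
falling-step (suc n) zero    = refl
falling-step (suc n) (suc k) = begin
  suc n * falling n (suc k)       ≡⟨ cong (suc n *_) (falling-step n k) ⟩
  suc n * ((n ∸ k) * falling n k) ≡⟨ swap (suc n) (n ∸ k) (falling n k) ⟩
  (n ∸ k) * (suc n * falling n k) ∎
  where
  swap : ∀ a b c → a * (b * c) ≡ b * (a * c)
  swap = solve-∀

falling-overflow : ∀ {n k} → n < k → falling n k ≡ 0
falling-overflow {zero}  {suc k} _         = refl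
falling-overflow {suc n} {suc k} (s≤s n<k) rewrite falling-overflow n<k = *-zeroʳ n

P≡falling : ∀ n k → n P k ≡ falling n k
P≡falling n k with k ≤ᵇ n in eq
... | true  = P′≡falling k
  where
  P′≡falling : ∀ k → n P′ k ≡ falling n k
  P′≡falling zero    = refl
  P′≡falling (suc k) = trans (cong ((n ∸ k) *_) (P′≡falling k)) (sym (falling-step n k))
... | false = sym (falling-overflow {n} {k} (≰⇒> λ k≤n → subst T eq (≤⇒≤ᵇ k≤n)))

falling-pascal : ∀ n k → falling (suc n) k ≡ falling n k + k * falling n (k ∸ 1)
falling-pascal n zero    = refl
falling-pascal n (suc j) with j ≤? n
... | yes j≤n = begin
  suc n * falling n j                       ≡⟨ cong (_* falling n j) split ⟨
  ((n ∸ j) + suc j) * falling n j           ≡⟨ *-distribʳ-+ (falling n j) (n ∸ j) (suc j) ⟩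
  (n ∸ j) * falling n j + suc j * falling n j
    ≡⟨ cong (_+ suc j * falling n j) (falling-step n j) ⟨
  falling n (suc j) + suc j * falling n j   ∎
  where
  split : (n ∸ j) + suc j ≡ suc n
  split = trans (+-suc (n ∸ j) j) (cong suc (m∸n+n≡m j≤n))
... | no j≰n rewrite falling-overflow (≰⇒> j≰n) | falling-overflow (m<n⇒m<1+n (≰⇒> j≰n))
                   | *-zeroʳ n | *-zeroʳ j = refl

P-pascal : ∀ n k → suc n P k ≡ n P k + k * (n P (k ∸ 1))
P-pascal n k rewrite P≡falling (suc n) k | P≡falling n k | P≡falling n (k ∸ 1) =
  falling-pascal n k

C-absorption : ∀ m k → (suc m C suc k) * suc k ≡ suc m * (m C k)
C-absorption zero    zero    = refl
C-absorption zero    (suc k) = refl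
C-absorption (suc m) zero    = cong (_* 1) (nC1≡n (suc (suc m)))
C-absorption (suc m) (suc k) = begin
  (suc (suc m) C suc (suc k)) * suc (suc k)
    ≡⟨ cong (_* suc (suc k)) (nCk+nC[k+1]≡[n+1]C[k+1] (suc m) (suc k)) ⟨
  (X + Y) * suc (suc k)
    ≡⟨ *-distribʳ-+ (suc (suc k)) X Y ⟩
  X * suc (suc k) + Y * suc (suc k)
    ≡⟨ cong₂ _+_ (*-suc X (suc k)) (C-absorption m (suc k)) ⟩
  (X + X * suc k) + suc m * (m C suc k)
    ≡⟨ cong (λ z → (X + z) + suc m * (m C suc k)) (C-absorption m k) ⟩
  (X + suc m * (m C k)) + suc m * (m C suc k)
    ≡⟨ regroup X (suc m) (m C k) (m C suc k) ⟩
  X + suc m * (m C k + m C suc k)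
    ≡⟨ cong (λ z → X + suc m * z) (nCk+nC[k+1]≡[n+1]C[k+1] m k) ⟩
  suc (suc m) * (suc m C suc k) ∎
  where
  X = suc m C suc k
  Y = suc m C suc (suc k)
  regroup : ∀ a b c d → (a + b * c) + b * d ≡ a + b * (c + d)
  regroup = solve-∀

sum1to-cong : ∀ N {f g : ℕ → ℕ} → (∀ k → f (suc k) ≡ g (suc k)) → sum1to N f ≡ sum1to N g
sum1to-cong zero    f≗g = refl
sum1to-cong (suc N) f≗g = cong₂ _+_ (sum1to-cong N f≗g) (f≗g N)

sum1to-zero : ∀ N (f : ℕ → ℕ) → (∀ k → f (suc k) ≡ 0) → sum1to N f ≡ 0
sum1to-zero zero    f f≗0 = refl
sum1to-zero (suc N) f f≗0 rewrite sum1to-zero N f f≗0 | f≗0 N = refl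

sum1to-+ : ∀ N (f g : ℕ → ℕ) → sum1to N (λ k → f k + g k) ≡ sum1to N f + sum1to N g
sum1to-+ zero    f g = refl
sum1to-+ (suc N) f g rewrite sum1to-+ N f g =
  interchange (sum1to N f) (sum1to N g) (f (suc N)) (g (suc N))
  where
  interchange : ∀ a b c d → a + b + (c + d) ≡ a + c + (b + d)
  interchange = solve-∀

sum1to-scale : ∀ N c (f : ℕ → ℕ) → sum1to N (λ k → c * f k) ≡ c * sum1to N f
sum1to-scale zero    c f = sym (*-zeroʳ c)
sum1to-scale (suc N) c f rewrite sum1to-scale N c f = sym (*-distribˡ-+ c (sum1to N f) (f (suc N)))

sum1to-shift : ∀ N (g : ℕ → ℕ) → sum1to (suc N) (λ k → g (k ∸ 1)) ≡ g 0 + sum1to N g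
sum1to-shift zero    g = +-comm 0 (g 0)
sum1to-shift (suc N) g rewrite sum1to-shift N g = +-assoc (g 0) (sum1to N g) (g (suc N))

-- The k-th summand of  formula m (n+1) = ∑_{k=1}^{n+1} term m n k.
term : ℕ → ℕ → ℕ → ℕ
term m n k = (m C k) * k * (n P (k ∸ 1))

term-rec : ∀ m n k → term (suc m) (suc n) (suc k) ≡ term (suc m) n (suc k) + suc m * term m n k
term-rec m n k = begin
  X * suc k * (suc n P k)
    ≡⟨ cong (X * suc k *_) (P-pascal n k) ⟩
  X * suc k * (A + k * B)
    ≡⟨ *-distribˡ-+ (X * suc k) A (k * B) ⟩
  X * suc k * A + X * suc k * (k * B)
    ≡⟨ cong (λ z → X * suc k * A + z * (k * B)) (C-absorption m k) ⟩
  X * suc k * A + suc m * (m C k) * (k * B)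
    ≡⟨ cong (X * suc k * A +_) (reassoc (suc m) (m C k) k B) ⟩
  X * suc k * A + suc m * ((m C k) * k * B) ∎
  where
  X = suc m C suc k
  A = n P k
  B = n P (k ∸ 1)
  reassoc : ∀ a b c d → a * b * (c * d) ≡ a * (b * c * d)
  reassoc = solve-∀

formula-base : ∀ m → formula m 1 ≡ m
formula-base m = trans (*-identityʳ ((m C 1) * 1)) (trans (*-identityʳ (m C 1)) (nC1≡n m))

-- c(0,n) = 0: every summand contains C(0,k) = 0 with k ≥ 1.
formula-empty : ∀ n → formula 0 (suc n) ≡ 0
formula-empty n = sum1to-zero (suc n) (term 0 n) (λ k → refl)

formula-rec : ∀ m n → formula (suc m) (suc (suc n)) ≡ formula (suc m) (suc n) + suc m * formula m (suc n)
formula-rec m n = begin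
  sum1to (2 + n) (term (suc m) (suc n))
    ≡⟨ sum1to-cong (2 + n) (term-rec m n) ⟩
  sum1to (2 + n) (λ k → term (suc m) n k + suc m * term m n (k ∸ 1))
    ≡⟨ sum1to-+ (2 + n) (term (suc m) n) _ ⟩
  sum1to (2 + n) (term (suc m) n) + sum1to (2 + n) (λ k → suc m * term m n (k ∸ 1))
    ≡⟨ cong₂ _+_ last-vanishes (sum1to-scale (2 + n) (suc m) (λ k → term m n (k ∸ 1))) ⟩
  sum1to (1 + n) (term (suc m) n) + suc m * sum1to (2 + n) (λ k → term m n (k ∸ 1))
    ≡⟨ cong (λ z → sum1to (1 + n) (term (suc m) n) + suc m * z) (sum1to-shift (suc n) (term m n)) ⟩
  sum1to (1 + n) (term (suc m) n) + suc m * (term m n 0 + sum1to (1 + n) (term m n))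
    ≡⟨ cong (λ z → sum1to (1 + n) (term (suc m) n) + suc m * (z + sum1to (1 + n) (term m n)))
            (*-zeroʳ (m C 0)) ⟩
  sum1to (1 + n) (term (suc m) n) + suc m * sum1to (1 + n) (term m n) ∎
  where
  -- The summand k = n+2 vanishes because (n)_{n+1} = 0.
  last-vanishes : sum1to (2 + n) (term (suc m) n) ≡ sum1to (1 + n) (term (suc m) n)
  last-vanishes rewrite P≡falling n (suc n) | falling-overflow {n} ≤-refl
                      | *-zeroʳ ((suc m C (2 + n)) * (2 + n)) = +-identityʳ _

module _ {m : ℕ} where

  -- A re-entry: positions i < j with w_i = w_{j+1} ≠ w_j.  Splitting ≠ into < and >
  -- gives exactly the two patterns 1-21 and 2-12.
  HasReentry : ∀ {n} → Word m n → Set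
  HasReentry {n} w = ∃[ i ] ∃[ j ] Σ (suc (toℕ j) < n) λ j+1<n →
    (toℕ i < toℕ j) × (lookup w i ≡ lookup w (fromℕ< j+1<n)) ×
    ¬ (lookup w (fromℕ< j+1<n) ≡ lookup w j)

  avoids⇒no-reentry : ∀ {n} (w : Word m n) → Avoids w → ¬ HasReentry w
  avoids⇒no-reentry w (no1-21 , no2-12) (i , j , j+1<n , i<j , same , changed)
    with FP.<-cmp (lookup w (fromℕ< j+1<n)) (lookup w j)
  ... | tri< lt _ _ = no1-21 (i , j , j+1<n , i<j , same , lt)
  ... | tri≈ _ eq _ = changed eq
  ... | tri> _ _ gt = no2-12 (i , j , j+1<n , i<j , same , gt)

  no-reentry⇒avoids : ∀ {n} (w : Word m n) → ¬ HasReentry w → Avoids w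
  no-reentry⇒avoids w none =
      (λ (i , j , j+1<n , i<j , same , lt) → none (i , j , j+1<n , i<j , same , λ eq → FP.<-irrefl eq lt))
    , (λ (i , j , j+1<n , i<j , same , gt) → none (i , j , j+1<n , i<j , same , λ eq → FP.<-irrefl (sym eq) gt))

  -- OnlyLeading a w: every occurrence of a in w, except at its front, is immediately
  -- preceded by a; equivalently the occurrences of a form an initial run of w (possibly empty).
  OnlyLeading : ∀ {n} → Fin m → Word m n → Set
  OnlyLeading a []          = ⊤
  OnlyLeading a (b ∷ [])    = ⊤
  OnlyLeading a (b ∷ c ∷ w) = (c ≡ a → b ≡ a) × OnlyLeading a (c ∷ w)

  -- Clustered w: the occurrences of every letter of w form one contiguous block.
  Clustered : ∀ {n} → Word m n → Set
  Clustered []      = ⊤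
  Clustered (a ∷ w) = Clustered w × OnlyLeading a w

  OnlyLeading⇒preceded : ∀ {n} a (w : Word m n) → OnlyLeading a w →
    ∀ j (j+1<n : suc (toℕ j) < n) → lookup w (fromℕ< j+1<n) ≡ a → lookup w j ≡ a
  OnlyLeading⇒preceded a (b ∷ c ∷ w) (here , _)    F.zero    (s≤s (s≤s z≤n)) = here
  OnlyLeading⇒preceded a (b ∷ c ∷ w) (_ , further) (F.suc j) (s≤s j+1<n)     =
    OnlyLeading⇒preceded a (c ∷ w) further j j+1<n

  preceded⇒OnlyLeading : ∀ {n} a (w : Word m n) →
    (∀ j (j+1<n : suc (toℕ j) < n) → lookup w (fromℕ< j+1<n) ≡ a → lookup w j ≡ a) →
    OnlyLeading a w
  preceded⇒OnlyLeading a []          preceded = tt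
  preceded⇒OnlyLeading a (b ∷ [])    preceded = tt
  preceded⇒OnlyLeading a (b ∷ c ∷ w) preceded =
    preceded F.zero (s≤s (s≤s z≤n)) , preceded⇒OnlyLeading a (c ∷ w) (λ j j+1<n → preceded (F.suc j) (s≤s j+1<n))

  -- A re-entry starting at the first letter a contradicts OnlyLeading a; later ones lie in the tail.
  clustered⇒no-reentry : ∀ {n} (w : Word m n) → Clustered w → ¬ HasReentry w
  clustered⇒no-reentry (a ∷ w) (_ , leading) (F.zero , F.suc j , s≤s j+1<n , _ , same , changed) =
    changed (trans (sym same) (sym (OnlyLeading⇒preceded a w leading j j+1<n (sym same))))
  clustered⇒no-reentry (a ∷ w) (clustered , _) (F.suc i , F.suc j , s≤s j+1<n , s≤s i<j , same , changed) =
    clustered⇒no-reentry w clustered (i , j , j+1<n , i<j , same , changed)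

  no-reentry⇒clustered : ∀ {n} (w : Word m n) → ¬ HasReentry w → Clustered w
  no-reentry⇒clustered []      none = tt
  no-reentry⇒clustered (a ∷ w) none =
      no-reentry⇒clustered w (λ (i , j , j+1<n , i<j , same , changed) →
        none (F.suc i , F.suc j , s≤s j+1<n , s≤s i<j , same , changed))
    , preceded⇒OnlyLeading a w preceded
    where
    -- A re-entry starting at the first letter a would be forced otherwise.
    preceded : ∀ j (j+1<n : suc (toℕ j) < _) → lookup w (fromℕ< j+1<n) ≡ a → lookup w j ≡ a
    preceded j j+1<n is-a with lookup w j FP.≟ a
    ... | yes eq = eq
    ... | no  ne = ⊥-elim (none (F.zero , F.suc j , s≤s j+1<n , s≤s z≤n , sym is-a ,
                                   λ eq → ne (trans (sym eq) is-a)))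

  avoids⇒clustered : ∀ {n} (w : Word m n) → Avoids w → Clustered w
  avoids⇒clustered w = no-reentry⇒clustered w ∘′ avoids⇒no-reentry w

  clustered⇒avoids : ∀ {n} (w : Word m n) → Clustered w → Avoids w
  clustered⇒avoids w = no-reentry⇒avoids w ∘′ clustered⇒no-reentry w

module _ {m : ℕ} where

  OnlyLeading-prepend : ∀ {n} a (w : Word m n) → OnlyLeading a w → OnlyLeading a (a ∷ w)
  OnlyLeading-prepend a []      _       = tt
  OnlyLeading-prepend a (c ∷ w) leading = (λ _ → refl) , leading

  absent⇒OnlyLeading : ∀ {n} a (w : Word m n) → All (a ≢_) w → OnlyLeading a w
  absent⇒OnlyLeading a []          _                 = tt
  absent⇒OnlyLeading a (b ∷ [])    _                 = tt
  absent⇒OnlyLeading a (b ∷ c ∷ w) (_ ∷ a≢c ∷ a≢w) =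
    (λ c≡a → ⊥-elim (a≢c (sym c≡a))) , absent⇒OnlyLeading a (c ∷ w) (a≢c ∷ a≢w)

  OnlyLeading⇒absent : ∀ {n} a b (w : Word m n) → a ≢ b → OnlyLeading a (b ∷ w) → All (a ≢_) (b ∷ w)
  OnlyLeading⇒absent a b []      a≢b _                    = a≢b ∷ []
  OnlyLeading⇒absent a b (c ∷ w) a≢b (c≡a⇒b≡a , leading) =
    a≢b ∷ OnlyLeading⇒absent a c w (λ a≡c → a≢b (sym (c≡a⇒b≡a (sym a≡c)))) leading

module _ {m k : ℕ} (f : Fin m → Fin k) (f-injective : ∀ {x y} → f x ≡ f y → x ≡ y) where

  OnlyLeading-map : ∀ {n} a (w : Word m n) → OnlyLeading a w → OnlyLeading (f a) (map f w)
  OnlyLeading-map a []          _                    = tt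
  OnlyLeading-map a (b ∷ [])    _                    = tt
  OnlyLeading-map a (b ∷ c ∷ w) (c≡a⇒b≡a , leading) =
    (λ fc≡fa → cong f (c≡a⇒b≡a (f-injective fc≡fa))) , OnlyLeading-map a (c ∷ w) leading

  OnlyLeading-unmap : ∀ {n} a (w : Word m n) → OnlyLeading (f a) (map f w) → OnlyLeading a w
  OnlyLeading-unmap a []          _                    = tt
  OnlyLeading-unmap a (b ∷ [])    _                    = tt
  OnlyLeading-unmap a (b ∷ c ∷ w) (c≡a⇒b≡a , leading) =
    (λ c≡a → f-injective (c≡a⇒b≡a (cong f c≡a))) , OnlyLeading-unmap a (c ∷ w) leading

  Clustered-map : ∀ {n} (w : Word m n) → Clustered w → Clustered (map f w)
  Clustered-map []      _                    = tt
  Clustered-map (a ∷ w) (clustered , leading) = Clustered-map w clustered , OnlyLeading-map a w leading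

  Clustered-unmap : ∀ {n} (w : Word m n) → Clustered (map f w) → Clustered w
  Clustered-unmap []      _                    = tt
  Clustered-unmap (a ∷ w) (clustered , leading) = Clustered-unmap w clustered , OnlyLeading-unmap a w leading

module _ {m : ℕ} where

  deleteLetter : ∀ {n} a (v : Word (suc m) n) → All (a ≢_) v → Word m n
  deleteLetter a []      []            = []
  deleteLetter a (x ∷ v) (a≢x ∷ a≢v) = punchOut a≢x ∷ deleteLetter a v a≢v

  reinsert-deleteLetter : ∀ {n} a (v : Word (suc m) n) (a∉v : All (a ≢_) v) →
    map (punchIn a) (deleteLetter a v a∉v) ≡ v
  reinsert-deleteLetter a []      []            = refl
  reinsert-deleteLetter a (x ∷ v) (a≢x ∷ a≢v) =
    cong₂ _∷_ (punchIn-punchOut a≢x) (reinsert-deleteLetter a v a≢v)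

  punchIn-avoids : ∀ {n} a (u : Word m n) → All (a ≢_) (map (punchIn a) u)
  punchIn-avoids a []      = []
  punchIn-avoids a (x ∷ u) = (λ a≡x → punchInᵢ≢i a x (sym a≡x)) ∷ punchIn-avoids a u

  deleteLetter-reinsert : ∀ {n} a (u : Word m n) (a∉u : All (a ≢_) (map (punchIn a) u)) →
    deleteLetter a (map (punchIn a) u) a∉u ≡ u
  deleteLetter-reinsert a []      []            = refl
  deleteLetter-reinsert a (x ∷ u) (a≢x ∷ a≢u) =
    cong₂ _∷_ (punchOut-punchIn a) (deleteLetter-reinsert a u a≢u)

Avoiding : ℕ → ℕ → Set
Avoiding m n = Σ (Word m n) Avoids

-- Avoids w is a pair of negations, hence proof-irrelevant: words determine elements.
Avoiding-≡ : ∀ {m n} {w w′ : Word m n} {p : Avoids w} {p′ : Avoids w′} → w ≡ w′ → (w , p) ≡ (w′ , p′)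
Avoiding-≡ refl = refl

clustered : ∀ {m n} (w : Word m n) → Clustered w → Avoiding m n
clustered w c = w , clustered⇒avoids w c

module _ {m n : ℕ} where

  decompose : Avoiding (suc m) (suc (suc n)) → Avoiding (suc m) (suc n) ⊎ (Fin (suc m) × Avoiding m (suc n))
  decompose (a ∷ b ∷ w , avoids) with a FP.≟ b
  ... | yes _  = inj₁ (clustered (b ∷ w) (proj₁ (avoids⇒clustered (a ∷ b ∷ w) avoids)))
  ... | no a≢b = inj₂ (a , clustered u (Clustered-unmap (punchIn a) (punchIn-injective a _ _) u rest))
    where
    a∉rest = OnlyLeading⇒absent a b w a≢b (proj₂ (avoids⇒clustered (a ∷ b ∷ w) avoids))
    u      = deleteLetter a (b ∷ w) a∉rest
    rest : Clustered (map (punchIn a) u)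
    rest = subst Clustered (sym (reinsert-deleteLetter a (b ∷ w) a∉rest))
                 (proj₁ (avoids⇒clustered (a ∷ b ∷ w) avoids))

  compose : Avoiding (suc m) (suc n) ⊎ (Fin (suc m) × Avoiding m (suc n)) → Avoiding (suc m) (suc (suc n))
  compose (inj₁ (b ∷ w , avoids)) =
    clustered (b ∷ b ∷ w) (c , OnlyLeading-prepend b w (proj₂ c))
    where c = avoids⇒clustered (b ∷ w) avoids
  compose (inj₂ (a , u , avoids)) =
    clustered (a ∷ map (punchIn a) u)
      ( Clustered-map (punchIn a) (punchIn-injective a _ _) u (avoids⇒clustered u avoids)
      , absent⇒OnlyLeading a _ (punchIn-avoids a u))

  decompose-compose : ∀ y → decompose (compose y) ≡ y
  decompose-compose (inj₁ (b ∷ w , _)) with b FP.≟ b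
  ... | yes _  = refl
  ... | no b≢b = ⊥-elim (b≢b refl)
  decompose-compose (inj₂ (a , x ∷ u , _)) with a FP.≟ punchIn a x
  ... | yes a≡x = ⊥-elim (punchInᵢ≢i a x (sym a≡x))
  ... | no  _   = cong (λ v → inj₂ (a , v)) (Avoiding-≡ (deleteLetter-reinsert a (x ∷ u) _))

  compose-decompose : ∀ x → compose (decompose x) ≡ x
  compose-decompose (a ∷ b ∷ w , _) with a FP.≟ b
  ... | yes refl = refl
  ... | no  _    = Avoiding-≡ (cong (a ∷_) (reinsert-deleteLetter a (b ∷ w) _))

  decomposition : Avoiding (suc m) (suc (suc n)) ↔ (Avoiding (suc m) (suc n) ⊎ (Fin (suc m) × Avoiding m (suc n)))
  decomposition = mk↔ₛ′ decompose compose decompose-compose compose-decompose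

single-letters : ∀ m → Avoiding m 1 ↔ Fin m
single-letters m = mk↔ₛ′ (λ { (a ∷ [] , _) → a }) (λ a → clustered (a ∷ []) (tt , tt))
                         (λ _ → refl) (λ { (a ∷ [] , _) → refl })

empty-alphabet : ∀ n → Avoiding 0 (suc n) ↔ Fin 0
empty-alphabet n = mk↔ₛ′ (λ { (() ∷ _ , _) }) (λ ()) (λ ()) (λ { (() ∷ _ , _) })

sum-of-products : ∀ a m b → (Fin a ⊎ (Fin (suc m) × Fin b)) ↔ Fin (a + suc m * b)
sum-of-products a m b = ↔-sym (↔-trans +↔⊎ (↔-refl ⊎-↔ *↔× {suc m}))

avoiding-count : ∀ m n → Avoiding m (suc n) ↔ Fin (formula m (suc n))
avoiding-count m       zero    rewrite formula-base m  = single-letters m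
avoiding-count zero    (suc n) rewrite formula-empty (suc n) = empty-alphabet (suc n)
avoiding-count (suc m) (suc n) rewrite formula-rec m n =
  ↔-trans decomposition
    (↔-trans (avoiding-count (suc m) n ⊎-↔ (↔-refl ×-↔ avoiding-count m n))
             (sum-of-products _ m _))

-- The count holds for every alphabet size (both sides vanish for m = 0); only n ≥ 1 is needed.
mainTheorem6 : (m n : ℕ) → 1 ≤ m → 1 ≤ n → Σ (Word m n) Avoids ↔ Fin (formula m n)
mainTheorem6 m (suc n) _ _ = avoiding-count m n
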